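{- Let $\mathcal H=(V,E)$ be an $r$-uniform hypergraph with $m=|E|\le 4$ and let $\eta$ be any bijection from $E$ to $[m]$. Then for each edge $e$ of $\mathcal H$ and each integer $k$, $F_\eta(\mathcal H,e,k)\ge 0$ holds whenever either $|E_{r-1}(e)|\le 1$ and $k\ge 2$, or $|E_{r-1}(e)|\ge 2$ and $k\ge m-1$.
   Context: Hypergraphs are finite; every edge has at least $2$ vertices and no edge is contained in another; $\mathcal H$ is $r$-uniform if all edges have exactly $r$ vertices; let $n=|V|$. $[m]=\{1,\dots,m\}$. For $A\subseteq E$, $c(A)$ is the number of connected components of the spanning subhypergraph $(V,A)$. For $F\subseteq E$, $V(F)=\bigcup_{e\in F}e$. A $\delta$-cycle is a minimal edge set $F$ such that $e\subseteq V(F\setminus\{e\})$ for every $e\in F$. A broken-$\delta$-cycle (w.r.t. $\eta$) is obtained from a $\delta$-cycle $C$ by deleting its edge with smallest $\eta$-value. $\mathcal{NB}(\mathcal H)$ is the set of subsets of $E$ containing no broken-$\delta$-cycle; $\mathcal{NB}_i(\mathcal H,e)$ is the set of $A\in\mathcal{NB}(\mathcal H)$ with $e\in A$, $|A|=i$. $E_{r-1}(e)$ is the set of edges $e'$ with $|e\cap e'|=r-1$; $\mathcal{NB}^*_2(\mathcal H,e)=\{\{e,e'\}\in\mathcal{NB}_2(\mathcal H,e): e'\in E_{r-1}(e)\}$. Finally $$F_\eta(\mathcal H,e,k)=1-\frac{|\mathcal{NB}^*_2(\mathcal H,e)|}{k}-\frac{|\mathcal{NB}_2(\mathcal H,e)\setminus\mathcal{NB}^*_2(\mathcal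 H,e)|}{k^2}+\sum_{2\le i\le (m+1)/2}\ \sum_{A\in\mathcal{NB}_{2i-1}(\mathcal H,e)}\frac{k^{c(A)-1-(n-r)}}{2i-1}-\sum_{2\le i\le m/2}\ \sum_{A\in\mathcal{NB}_{2i}(\mathcal H,e)}k^{c(A)-1-(n-r)}.$$ -}

module Defs where

open import Data.Bool using (Bool; true; false; _∧_; _∨_; not; T)
open import Data.Nat as ℕ using (ℕ; zero; suc; _∸_; ⌊_/2⌋)
open import Data.Fin as Fin using (Fin; toℕ)
open import Data.Fin.Subset as S using (Subset; inside; outside; ⁅_⁆; _∪_; _∩_; ∣_∣; _⊆_)
open import Data.Fin.Subset.Properties using (_⊆?_; _∈?_)
open import Data.Fin.Permutation using (Permutation′; _⟨$⟩ʳ_)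
open import Data.Vec as Vec using (Vec; []; _∷_)
open import Data.List as List using (List; []; _∷_; _++_; map; filter; filterᵇ; foldr; allFin; length; upTo)
open import Data.Bool.ListAction using (all; any)
open import Data.Integer as ℤ using (ℤ; +_; -[1+_])
open import Data.Rational as ℚ using (ℚ; 0ℚ; 1ℚ; 1/_; ≢-nonZero)
open import Data.Rational.Properties using () renaming (_≟_ to _≟ℚ_)
open import Relation.Nullary using (¬_; yes; no)
open import Relation.Nullary.Decidable using (⌊_⌋)
open import Relation.Binary.PropositionalEquality using (_≡_; _≢_)

record Hypergraph (n m : ℕ) : Set where
  field
    edge      : Fin m → Subset n
    edge-size : ∀ i → 2 ℕ.≤ ∣ edge i ∣
    antichain : ∀ i j → i ≢ j → ¬ (edge i ⊆ edge j)
open Hypergraph public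

Uniform : ∀ {n m} → Hypergraph n m → ℕ → Set
Uniform H r = ∀ i → ∣ edge H i ∣ ≡ r

allSubsets : (m : ℕ) → List (Subset m)
allSubsets zero    = [] ∷ []
allSubsets (suc m) = map (outside ∷_) (allSubsets m) ++ map (inside ∷_) (allSubsets m)

_∈ᵇ_ : ∀ {m} → Fin m → Subset m → Bool
i ∈ᵇ A = ⌊ i ∈? A ⌋

_⊆ᵇ_ : ∀ {m} → Subset m → Subset m → Bool
A ⊆ᵇ B = ⌊ A ⊆? B ⌋

_⊂ᵇ_ : ∀ {m} → Subset m → Subset m → Bool
A ⊂ᵇ B = (A ⊆ᵇ B) ∧ not (B ⊆ᵇ A)

nonemptyᵇ : ∀ {m} → Subset m → Bool
nonemptyᵇ {m} A = any (_∈ᵇ A) (allFin m)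

_==ℕ_ : ℕ → ℕ → Bool
a ==ℕ b = ⌊ a ℕ.≟ b ⌋

_≤ℕ_ : ℕ → ℕ → Bool
a ≤ℕ b = ⌊ a ℕ.≤? b ⌋

members : ∀ {m} → Subset m → List (Fin m)
members {m} A = filter (_∈? A) (allFin m)

VE : ∀ {n m} → Hypergraph n m → Subset m → Subset n
VE {n} H F = foldr _∪_ S.⊥ (map (edge H) (members F))

δ-property : ∀ {n m} → Hypergraph n m → Subset m → Bool
δ-property H F = all (λ i → edge H i ⊆ᵇ VE H (F S.- i)) (members F)

isδCycle : ∀ {n m} → Hypergraph n m → Subset m → Bool
isδCycle {m = m} H F =
  nonemptyᵇ F ∧ δ-property H F ∧
  not (any (λ F′ → nonemptyᵇ F′ ∧ (F′ ⊂ᵇ F) ∧ δ-property H F′) (allSubsets m))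

isηMin : ∀ {m} → Permutation′ m → Subset m → Fin m → Bool
isηMin η C i = (i ∈ᵇ C) ∧ all (λ j → toℕ (η ⟨$⟩ʳ i) ≤ℕ toℕ (η ⟨$⟩ʳ j)) (members C)

-- the broken-δ-cycle obtained from C is contained in A
brokenIn : ∀ {m} → Permutation′ m → Subset m → Subset m → Bool
brokenIn {m} η C A = any (λ i → isηMin η C i ∧ ((C S.- i) ⊆ᵇ A)) (allFin m)

isNB : ∀ {n m} → Hypergraph n m → Permutation′ m → Subset m → Bool
isNB {m = m} H η A = not (any (λ C → isδCycle H C ∧ brokenIn η C A) (allSubsets m))

NB : ∀ {n m} → Hypergraph n m → Permutation′ m → ℕ → Fin m → List (Subset m)
NB {m = m} H η i e = filterᵇ (λ A → isNB H η A ∧ (e ∈ᵇ A) ∧ (∣ A ∣ ==ℕ i)) (allSubsets m)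

inEr-1 : ∀ {n m} → Hypergraph n m → ℕ → Fin m → Fin m → Bool
inEr-1 H r e e′ = ∣ edge H e ∩ edge H e′ ∣ ==ℕ (r ∸ 1)

Er-1 : ∀ {n m} → Hypergraph n m → ℕ → Fin m → List (Fin m)
Er-1 {m = m} H r e = filterᵇ (inEr-1 H r e) (allFin m)

NB*2 : ∀ {n m} → Hypergraph n m → ℕ → Permutation′ m → Fin m → List (Subset m)
NB*2 H r η e =
  filterᵇ (λ A → any (λ e′ → inEr-1 H r e e′ ∧ (A ⊆ᵇ (⁅ e ⁆ ∪ ⁅ e′ ⁆))) (members A)) (NB H η 2 e)

NB2-not* : ∀ {n m} → Hypergraph n m → ℕ → Permutation′ m → Fin m → List (Subset m)
NB2-not* H r η e =
  filterᵇ (λ A → not (any (λ e′ → inEr-1 H r e e′ ∧ (A ⊆ᵇ (⁅ e ⁆ ∪ ⁅ e′ ⁆))) (members A))) (NB H η 2 e)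

iter : ∀ {X : Set} → ℕ → (X → X) → X → X
iter zero    f x = x
iter (suc k) f x = f (iter k f x)

closeStep : ∀ {n m} → Hypergraph n m → Subset m → Subset n → Subset n
closeStep H A X =
  foldr _∪_ X (map (edge H) (filterᵇ (λ i → nonemptyᵇ (edge H i ∩ X)) (members A)))

-- vertex set of the component of (V, A) containing v
-- (n iterations of closeStep reach the fixed point)
component : ∀ {n m} → Hypergraph n m → Subset m → Fin n → Subset n
component {n} H A v = iter n (closeStep H A) ⁅ v ⁆

-- number of components = number of vertices that are the least vertex of their component
c : ∀ {n m} → Hypergraph n m → Subset m → ℕ
c {n} H A =
  length (filterᵇ (λ v → all (λ u → toℕ v ≤ℕ toℕ u) (members (component H A v))) (allFin n))

powℕ : ℚ → ℕ → ℚ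
powℕ q zero    = 1ℚ
powℕ q (suc k) = q ℚ.* powℕ q k

-- integer powers; q^(-j) = (1/q)^j for q ≠ 0 (the value for q = 0 and a
-- negative exponent is irrelevant: it is only used with q = k ≥ 2)
powℤ : ℚ → ℤ → ℚ
powℤ q (+ j) = powℕ q j
powℤ q -[1+ j ] with q ≟ℚ 0ℚ
... | yes _  = 0ℚ
... | no q≢0 = powℕ (1/_ q {{≢-nonZero q≢0}}) (suc j)

sumℚ : List ℚ → ℚ
sumℚ = foldr ℚ._+_ 0ℚ

sumFromTo : ℕ → ℕ → (ℕ → ℚ) → ℚ
sumFromTo lo hi f = sumℚ (map f (filterᵇ (lo ≤ℕ_) (upTo (suc hi))))

ℕ→ℚ : ℕ → ℚ
ℕ→ℚ a = (+ a) ℚ./ 1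

F : ∀ {n m} → Hypergraph n m → (r : ℕ) → Permutation′ m → Fin m → ℤ → ℚ
F {n} {m} H r η e k =
  ((((1ℚ ℚ.- (ℕ→ℚ (length (NB*2 H r η e)) ℚ.* powℤ kq (ℤ.- (+ 1))))
         ℚ.- (ℕ→ℚ (length (NB2-not* H r η e)) ℚ.* powℤ kq (ℤ.- (+ 2))))
         ℚ.+ sumFromTo 2 ⌊ m ℕ.+ 1 /2⌋ (λ i →
               sumℚ (map (λ A → powℤ kq (expo A) ℚ.* ((+ 1) ℚ./ suc (2 ℕ.* (i ∸ 1))))
                         (NB H η (2 ℕ.* i ∸ 1) e))))
         ℚ.- sumFromTo 2 ⌊ m /2⌋ (λ i →
               sumℚ (map (λ A → powℤ kq (expo A)) (NB H η (2 ℕ.* i) e))))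
  where
  kq : ℚ
  kq = k ℚ./ 1
  expo : Subset m → ℤ
  expo A = ((+ c H A) ℤ.- (+ 1)) ℤ.- ((+ n) ℤ.- (+ r))

-- Write F = L + O − E, where L = 1 − a/k − b/k² with a = |NB*₂(e)| and
-- b = |NB₂(e) ∖ NB*₂(e)|, and O, E are the sums over NB_{2i−1}(e) and NB_{2i}(e).
-- There are m − 1 two-element edge sets through e, so a + b ≤ m − 1, and
-- a ≤ |E_{r−1}(e)|. With t = 1/k, L = 1 − a t − b t². If k ≥ m − 1, then
-- a t + b t² ≤ (a + b) t ≤ 1. If k ≥ 2 and |E_{r−1}(e)| ≤ 1, then a ≤ 1 and
-- a + b ≤ 3, and as L is antitone in a, b and t it suffices to evaluate the
-- worst cases at t = ½. O ≥ 0 because k ≥ 1. E vanishes for m ≤ 3. For m = 4,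
-- NB₄(e) contains at most the whole edge set; as NB is closed under subsets and
-- k^{c(A)} decreases as A grows (components only merge), its weight is at most
-- the average weight of the three 3-sets through e, which then lie in NB₃(e).
-- The small counts are checked exhaustively for m ≤ 4.

module Submission where

open import Defs
open import Data.Bool using (Bool; true; false; _∧_; not; T)
import Data.Bool as Bool
open import Data.Bool.ListAction using (all; any; or)
open import Data.Fin using (Fin; toℕ; fromℕ<)
open import Data.Fin.Properties using (all?; toℕ-fromℕ<)
open import Data.Fin.Permutation using (Permutation′)
open import Data.Fin.Subset using (Subset; inside; outside; _∈_; _⊆_; _∪_; _∩_; ⁅_⁆; ∣_∣; ⊤)
open import Data.Fin.Subset.Properties using (_∈?_; ⊆⊤; x∈p∪q⁺; x∈p∪q⁻; x∈p∩q⁺; x∈p∩q⁻)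
import Data.Integer as ℤ
import Data.Integer.Properties as ℤP
open import Data.List using (List; []; _∷_; map; foldr; filterᵇ; length; allFin; upTo)
open import Data.List.Properties using (filter-all; filter-≐; length-filter; length-tabulate; map-cong)
import Data.List.Properties as List
open import Data.List.Membership.Propositional using () renaming (_∈_ to _∈ₗ_)
open import Data.List.Membership.Propositional.Properties using (∈-++⁺ˡ; ∈-++⁺ʳ; ∈-map⁺)
open import Data.List.Relation.Binary.Subset.Propositional using () renaming (_⊆_ to _⊆ₗ_)
open import Data.List.Relation.Binary.Subset.Propositional.Properties using (filter⁺′; map⁺; All-resp-⊇)
import Data.List.Relation.Binary.Sublist.Propositional as Sublist
import Data.List.Relation.Binary.Sublist.Propositional.Properties as Sublist
open import Data.List.Relation.Unary.All as All using (All; []; _∷_)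
open import Data.List.Relation.Unary.All.Properties using (all⁺; all⁻)
open import Data.List.Relation.Unary.Any as Any using (here; there)
open import Data.List.Relation.Unary.Any.Properties using (any⁺; any⁻)
import Data.Nat as ℕ
import Data.Nat.Coprimality as Coprime
import Data.Nat.Properties as ℕP
open import Data.Product using (_×_; _,_)
import Data.Rational as ℚ
open import Data.Sum using (_⊎_; inj₁; inj₂)
open import Data.Unit using (tt)
open import Data.Vec using ([]; _∷_; lookup; tabulate)
open import Data.Vec.Properties using (lookup∘tabulate)
import Data.Vec.Properties as Vec
open import Function using (_∘_)
open import Relation.Binary.PropositionalEquality
open import Relation.Nullary using (Dec; yes; no; contradiction)
open import Relation.Nullary.Decidable using (True; T?; toWitness; fromWitness)

module RationalEstimates where

  open import Data.Nat using (ℕ; zero; suc; z≤n; s≤s)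
  open import Data.Integer using (+_; -[1+_]; +≤+; -≤+; -≤-)
  open import Data.Rational
  open import Data.Rational.Properties

  ℕ→ℚ≡mkℚ : ∀ a → ℕ→ℚ a ≡ mkℚ (+ a) 0 (Coprime.sym (Coprime.1-coprimeTo a))
  ℕ→ℚ≡mkℚ a = normalize-coprime (Coprime.sym (Coprime.1-coprimeTo a))

  ℕ→ℚ-nonNeg : ∀ a → NonNegative (ℕ→ℚ a)
  ℕ→ℚ-nonNeg a = normalize-nonNeg a 1

  ℕ→ℚ-mono-≤ : ∀ {a b} → a ℕ.≤ b → ℕ→ℚ a ≤ ℕ→ℚ b
  ℕ→ℚ-mono-≤ {a} {b} a≤b rewrite ℕ→ℚ≡mkℚ a | ℕ→ℚ≡mkℚ b =
    *≤* (subst₂ ℤ._≤_ (sym (ℤP.*-identityʳ (+ a))) (sym (ℤP.*-identityʳ (+ b))) (+≤+ a≤b))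

  ℕ→ℚ-+ : ∀ a b → ℕ→ℚ (a ℕ.+ b) ≡ ℕ→ℚ a + ℕ→ℚ b
  ℕ→ℚ-+ a b = begin
    + (a ℕ.+ b) / 1                    ≡⟨ cong (_/ 1) (cong₂ ℤ._+_ (ℤP.*-identityʳ (+ a)) (ℤP.*-identityʳ (+ b))) ⟨
    (+ a ℤ.* + 1 ℤ.+ + b ℤ.* + 1) / 1  ≡⟨ cong₂ _+_ (ℕ→ℚ≡mkℚ a) (ℕ→ℚ≡mkℚ b) ⟨
    ℕ→ℚ a + ℕ→ℚ b                      ∎
    where open ≡-Reasoning

  0≤1 : 0ℚ ≤ 1ℚ
  0≤1 = *≤* (+≤+ z≤n)

  p≤q⇒0≤q-p : ∀ {p q} → p ≤ q → 0ℚ ≤ q - p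
  p≤q⇒0≤q-p {p} {q} p≤q = subst (_≤ q - p) (+-inverseʳ p) (+-monoˡ-≤ (- p) p≤q)

  -‿mono-≤ : ∀ {p p′ q q′} → p ≤ p′ → q′ ≤ q → p - q ≤ p′ - q′
  -‿mono-≤ p≤p′ q′≤q = +-mono-≤ p≤p′ (neg-antimono-≤ q′≤q)

  *-mono-≤-nonNeg : ∀ {p q r s} → 0ℚ ≤ p → 0ℚ ≤ r → p ≤ q → r ≤ s → p * r ≤ q * s
  *-mono-≤-nonNeg {p} {q} {r} {s} 0≤p 0≤r p≤q r≤s = ≤-trans
    (*-monoʳ-≤-nonNeg r {{nonNegative 0≤r}} p≤q)
    (*-monoˡ-≤-nonNeg q {{nonNegative (≤-trans 0≤p p≤q)}} r≤s)

  1/-antimono-≤ : ∀ {p q} .{{_ : Positive p}} .{{_ : Positive q}} → p ≤ q →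
                  (1/ q) {{pos⇒nonZero q}} ≤ (1/ p) {{pos⇒nonZero p}}
  1/-antimono-≤ {p} {q} p≤q = *-cancelʳ-≤-pos p (begin
    1/q * p  ≤⟨ *-monoˡ-≤-nonNeg 1/q {{pos⇒nonNeg 1/q {{1/pos⇒pos q}}}} p≤q ⟩
    1/q * q  ≡⟨ *-inverseˡ q ⟩
    1ℚ       ≡⟨ *-inverseˡ p ⟨
    1/p * p  ∎)
    where
    open ≤-Reasoning
    instance
      _ = pos⇒nonZero p
      _ = pos⇒nonZero q
    1/p = 1/ p
    1/q = 1/ q

  powℕ-nonNeg : ∀ {q} → 0ℚ ≤ q → ∀ j → 0ℚ ≤ powℕ q j
  powℕ-nonNeg 0≤q zero    = 0≤1
  powℕ-nonNeg {q} 0≤q (suc j) = subst (_≤ q * powℕ q j) (*-zeroˡ (powℕ q j))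
    (*-monoʳ-≤-nonNeg (powℕ q j) {{nonNegative (powℕ-nonNeg 0≤q j)}} 0≤q)

  powℕ-monoʳ-≤ : ∀ {q} → 1ℚ ≤ q → ∀ {i j} → i ℕ.≤ j → powℕ q i ≤ powℕ q j
  powℕ-monoʳ-≤ {q} 1≤q i≤j = go (ℕP.≤⇒≤′ i≤j)
    where
    go : ∀ {i j} → i ℕ.≤′ j → powℕ q i ≤ powℕ q j
    go ℕ.≤′-refl          = ≤-refl
    go (ℕ.≤′-step {j} i≤j) = ≤-trans (go i≤j)
      (subst (_≤ q * powℕ q j) (*-identityˡ (powℕ q j))
        (*-monoʳ-≤-nonNeg (powℕ q j) {{nonNegative (powℕ-nonNeg (≤-trans 0≤1 1≤q) j)}} 1≤q))

  powℕ-antiʳ-≤ : ∀ {t} → 0ℚ ≤ t → t ≤ 1ℚ → ∀ {i j} → i ℕ.≤ j → powℕ t j ≤ powℕ t i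
  powℕ-antiʳ-≤ {t} 0≤t t≤1 i≤j = go (ℕP.≤⇒≤′ i≤j)
    where
    go : ∀ {i j} → i ℕ.≤′ j → powℕ t j ≤ powℕ t i
    go ℕ.≤′-refl          = ≤-refl
    go (ℕ.≤′-step {j} i≤j) = ≤-trans
      (subst (t * powℕ t j ≤_) (*-identityˡ (powℕ t j))
        (*-monoʳ-≤-nonNeg (powℕ t j) {{nonNegative (powℕ-nonNeg 0≤t j)}} t≤1))
      (go i≤j)

  module Reciprocal {q : ℚ} (1≤q : 1ℚ ≤ q) where

    instance
      q-positive : Positive q
      q-positive = positive (<-≤-trans (positive⁻¹ 1ℚ) 1≤q)

      q-nonZero : NonZero q
      q-nonZero = pos⇒nonZero q

    q≢0 : q ≢ 0ℚ
    q≢0 q≡0 = <-irrefl (sym q≡0) (positive⁻¹ q)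

    t : ℚ
    t = 1/ q

    0≤t : 0ℚ ≤ t
    0≤t = <⇒≤ (positive⁻¹ t {{1/pos⇒pos q}})

    t≤1 : t ≤ 1ℚ
    t≤1 = 1/-antimono-≤ 1≤q

    q*t≡1 : q * t ≡ 1ℚ
    q*t≡1 = *-inverseʳ q

    powℤ-negative : ∀ j → powℤ q -[1+ j ] ≡ powℕ t (suc j)
    powℤ-negative j with q ≟ 0ℚ
    ... | yes q≡0 = contradiction q≡0 q≢0
    ... | no _    = refl

  powℤ-nonNeg : ∀ {q} → 1ℚ ≤ q → ∀ x → 0ℚ ≤ powℤ q x
  powℤ-nonNeg 1≤q (+ j)    = powℕ-nonNeg (≤-trans 0≤1 1≤q) j
  powℤ-nonNeg 1≤q -[1+ j ] = subst (0ℚ ≤_) (sym (powℤ-negative j)) (powℕ-nonNeg 0≤t (suc j))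
    where open Reciprocal 1≤q

  powℤ-mono-≤ : ∀ {q} → 1ℚ ≤ q → ∀ {x y} → x ℤ.≤ y → powℤ q x ≤ powℤ q y
  powℤ-mono-≤ 1≤q (+≤+ i≤j) = powℕ-monoʳ-≤ 1≤q i≤j
  powℤ-mono-≤ 1≤q (-≤+ {i} {j}) rewrite Reciprocal.powℤ-negative 1≤q i =
    ≤-trans (powℕ-antiʳ-≤ 0≤t t≤1 (z≤n {suc i})) (powℕ-monoʳ-≤ 1≤q (z≤n {j}))
    where open Reciprocal 1≤q
  powℤ-mono-≤ 1≤q (-≤- {i} {j} j≤i)
    rewrite Reciprocal.powℤ-negative 1≤q i | Reciprocal.powℤ-negative 1≤q j =
    powℕ-antiʳ-≤ 0≤t t≤1 (s≤s j≤i)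
    where open Reciprocal 1≤q

  1-at-bt² : ℕ → ℕ → ℚ → ℚ
  1-at-bt² a b t = (1ℚ - ℕ→ℚ a * t) - ℕ→ℚ b * (t * t)

  1-at-bt²-antitone : ∀ {a a′ b b′ t t′} → a ℕ.≤ a′ → b ℕ.≤ b′ → 0ℚ ≤ t → t ≤ t′ →
                      1-at-bt² a′ b′ t′ ≤ 1-at-bt² a b t
  1-at-bt²-antitone {a} {a′} {b} {b′} {t} {t′} a≤a′ b≤b′ 0≤t t≤t′ =
    -‿mono-≤ (-‿mono-≤ (≤-refl {1ℚ}) at≤a′t′) bt²≤b′t′²
    where
    0≤t² : 0ℚ ≤ t * t
    0≤t² = subst (_≤ t * t) (*-zeroˡ t) (*-monoʳ-≤-nonNeg t {{nonNegative 0≤t}} 0≤t)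
    at≤a′t′ : ℕ→ℚ a * t ≤ ℕ→ℚ a′ * t′
    at≤a′t′ = *-mono-≤-nonNeg (nonNegative⁻¹ _ {{ℕ→ℚ-nonNeg a}}) 0≤t (ℕ→ℚ-mono-≤ a≤a′) t≤t′
    bt²≤b′t′² : ℕ→ℚ b * (t * t) ≤ ℕ→ℚ b′ * (t′ * t′)
    bt²≤b′t′² = *-mono-≤-nonNeg (nonNegative⁻¹ _ {{ℕ→ℚ-nonNeg b}}) 0≤t²
      (ℕ→ℚ-mono-≤ b≤b′) (*-mono-≤-nonNeg 0≤t 0≤t t≤t′ t≤t′)

  -- the two extreme cases (a , b) = (0 , 3) and (1 , 2) at t = ½ evaluate to ¼ and 0
  1-at-bt²-nonNeg-½ : ∀ {a b t} → a ℕ.≤ 1 → a ℕ.+ b ℕ.≤ 3 → 0ℚ ≤ t → t ≤ ½ →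
                      0ℚ ≤ 1-at-bt² a b t
  1-at-bt²-nonNeg-½ {zero} z≤n b≤3 0≤t t≤½ =
    ≤-trans (toWitness {a? = 0ℚ ≤? 1-at-bt² 0 3 ½} tt)
            (1-at-bt²-antitone {a′ = 0} {b′ = 3} z≤n b≤3 0≤t t≤½)
  1-at-bt²-nonNeg-½ {suc zero} (s≤s z≤n) (s≤s b≤2) 0≤t t≤½ =
    ≤-trans (toWitness {a? = 0ℚ ≤? 1-at-bt² 1 2 ½} tt)
            (1-at-bt²-antitone {a′ = 1} {b′ = 2} ℕP.≤-refl b≤2 0≤t t≤½)

  1-at-bt²-nonNeg : ∀ {a b t} → 0ℚ ≤ t → t ≤ 1ℚ → ℕ→ℚ (a ℕ.+ b) * t ≤ 1ℚ →
                    0ℚ ≤ 1-at-bt² a b t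
  1-at-bt²-nonNeg {a} {b} {t} 0≤t t≤1 [a+b]t≤1 = begin
    0ℚ                                     ≤⟨ p≤q⇒0≤q-p [a+b]t≤1 ⟩
    1ℚ - ℕ→ℚ (a ℕ.+ b) * t                 ≡⟨ cong (λ x → 1ℚ - x * t) (ℕ→ℚ-+ a b) ⟩
    1ℚ - (A + B) * t                       ≡⟨ cong (λ x → 1ℚ - x) (*-distribʳ-+ t A B) ⟩
    1ℚ - (A * t + B * t)                   ≡⟨ cong (λ x → 1ℚ + x) (neg-distrib-+ (A * t) (B * t)) ⟩
    1ℚ + (- (A * t) + - (B * t))           ≡⟨ +-assoc 1ℚ (- (A * t)) (- (B * t)) ⟨
    (1ℚ - A * t) - B * t                   ≤⟨ -‿mono-≤ (≤-refl {1ℚ - A * t}) Bt²≤Bt ⟩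
    (1ℚ - A * t) - B * (t * t)             ∎
    where
    open ≤-Reasoning
    A = ℕ→ℚ a
    B = ℕ→ℚ b
    Bt²≤Bt : B * (t * t) ≤ B * t
    Bt²≤Bt = *-monoˡ-≤-nonNeg B {{ℕ→ℚ-nonNeg b}}
      (subst (t * t ≤_) (*-identityʳ t) (*-monoˡ-≤-nonNeg t {{nonNegative 0≤t}} t≤1))

  sumℚ-nonNeg : ∀ {A : Set} (f : A → ℚ) → (∀ x → 0ℚ ≤ f x) → ∀ xs → 0ℚ ≤ sumℚ (map f xs)
  sumℚ-nonNeg f 0≤f []       = ≤-refl
  sumℚ-nonNeg f 0≤f (x ∷ xs) = +-mono-≤ (0≤f x) (sumℚ-nonNeg f 0≤f xs)

  sumFromTo-nonNeg : ∀ lo hi (f : ℕ → ℚ) → (∀ i → 0ℚ ≤ f i) → 0ℚ ≤ sumFromTo lo hi f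
  sumFromTo-nonNeg lo hi f 0≤f = sumℚ-nonNeg f 0≤f (filterᵇ (lo ≤ℕ_) (upTo (suc hi)))

  ⅓ : ℚ
  ⅓ = + 1 / 3

  ⅓-split : ∀ x → x * ⅓ + (x * ⅓ + (x * ⅓ + 0ℚ)) ≡ x
  ⅓-split x = begin
    x * ⅓ + (x * ⅓ + (x * ⅓ + 0ℚ))  ≡⟨ cong (λ y → x * ⅓ + (x * ⅓ + y)) (+-identityʳ (x * ⅓)) ⟩
    x * ⅓ + (x * ⅓ + x * ⅓)         ≡⟨ cong (λ y → x * ⅓ + y) (*-distribˡ-+ x ⅓ ⅓) ⟨
    x * ⅓ + x * (⅓ + ⅓)             ≡⟨ *-distribˡ-+ x ⅓ (⅓ + ⅓) ⟨
    x * 1ℚ                          ≡⟨ *-identityʳ x ⟩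
    x                               ∎
    where open ≡-Reasoning

  0≤p*q : ∀ {p q} → 0ℚ ≤ p → 0ℚ ≤ q → 0ℚ ≤ p * q
  0≤p*q {p} {q} 0≤p 0≤q =
    nonNegative⁻¹ _ {{nonNeg*nonNeg⇒nonNeg p {{nonNegative 0≤p}} q {{nonNegative 0≤q}}}}

  sum-filter-max≤⅓sum : ∀ {A : Set} (ν : A → Bool) (w : A → ℚ) {X} Ts → length Ts ≡ 3 →
    (∀ {Y} → T (ν X) → T (ν Y)) → (∀ Y → w X ≤ w Y) → (∀ Y → 0ℚ ≤ w Y) →
    sumℚ (map w (filterᵇ ν (X ∷ []))) ≤ sumℚ (map (λ Y → w Y * ⅓) (filterᵇ ν Ts))
  sum-filter-max≤⅓sum ν w {X} (Y₁ ∷ Y₂ ∷ Y₃ ∷ []) refl ν-down w-max 0≤w with ν X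
  ... | false = sumℚ-nonNeg (λ Y → w Y * ⅓) (λ Y → 0≤p*q (0≤w Y) (nonNegative⁻¹ ⅓))
                  (filterᵇ ν (Y₁ ∷ Y₂ ∷ Y₃ ∷ []))
  ... | true  = begin
    w X + 0ℚ                                     ≡⟨ +-identityʳ (w X) ⟩
    w X                                          ≡⟨ ⅓-split (w X) ⟨
    w X * ⅓ + (w X * ⅓ + (w X * ⅓ + 0ℚ))         ≤⟨ +-mono-≤ (≤⅓ Y₁) (+-mono-≤ (≤⅓ Y₂) (+-monoˡ-≤ 0ℚ (≤⅓ Y₃))) ⟩
    w Y₁ * ⅓ + (w Y₂ * ⅓ + (w Y₃ * ⅓ + 0ℚ))      ≡⟨ cong (sumℚ ∘ map (λ Y → w Y * ⅓)) all-accepted ⟨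
    sumℚ (map (λ Y → w Y * ⅓) (filterᵇ ν (Y₁ ∷ Y₂ ∷ Y₃ ∷ [])))  ∎
    where
    open ≤-Reasoning
    ≤⅓ : ∀ Y → w X * ⅓ ≤ w Y * ⅓
    ≤⅓ Y = *-monoʳ-≤-nonNeg ⅓ (w-max Y)
    all-accepted : filterᵇ ν (Y₁ ∷ Y₂ ∷ Y₃ ∷ []) ≡ Y₁ ∷ Y₂ ∷ Y₃ ∷ []
    all-accepted = filter-all (T? ∘ ν) (ν-down tt ∷ ν-down tt ∷ ν-down tt ∷ [])

  0≤p+q-r : ∀ {p q r} → 0ℚ ≤ p → r ≤ q → 0ℚ ≤ (p + q) - r
  0≤p+q-r {p} {q} {r} 0≤p r≤q = begin
    0ℚ            ≤⟨ +-mono-≤ 0≤p (p≤q⇒0≤q-p r≤q) ⟩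
    p + (q - r)   ≡⟨ +-assoc p q (- r) ⟨
    (p + q) - r   ∎
    where open ≤-Reasoning

open RationalEstimates

open import Data.Nat using (ℕ; zero; suc; z≤n; s≤s; _≤_; _+_; _∸_; ⌊_/2⌋)
open import Data.Integer using (ℤ; +_; +≤+; _-_) renaming (_≤_ to _≤ℤ_)
open import Data.Rational using (ℚ; 0ℚ; 1ℚ; _/_; nonNegative) renaming (_≤_ to _≤ℚ_)
open import Data.Rational.Properties
  using (nonNegative⁻¹; normalize-nonNeg; +-monoˡ-≤; *-identityʳ; *-monoʳ-≤-nonNeg; module ≤-Reasoning)

any-mono : ∀ {A : Set} {p q : A → Bool} → (∀ {x} → T (p x) → T (q x)) →
           ∀ xs → T (any p xs) → T (any q xs)
any-mono {p = p} {q} p⇒q xs = any⁺ q ∘ Any.map p⇒q ∘ any⁻ p xs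

∧-monoʳ : ∀ {a b c} → (T b → T c) → T (a ∧ b) → T (a ∧ c)
∧-monoʳ {true} b⇒c = b⇒c

not-antitone : ∀ {a b} → (T a → T b) → T (not b) → T (not a)
not-antitone {false} _ _ = tt
not-antitone {true} {false} a⇒b _ = a⇒b tt

filterᵇ-∧ : ∀ {A : Set} (p q : A → Bool) → filterᵇ (λ x → p x ∧ q x) ≗ filterᵇ p ∘ filterᵇ q
filterᵇ-∧ p q [] = refl
filterᵇ-∧ p q (x ∷ xs) with q x
... | false with p x
...   | false = filterᵇ-∧ p q xs
...   | true  = filterᵇ-∧ p q xs
filterᵇ-∧ p q (x ∷ xs) | true with p x
...   | false = filterᵇ-∧ p q xs
...   | true  = cong (x ∷_) (filterᵇ-∧ p q xs)

length-filterᵇ-partition : ∀ {A : Set} (p : A → Bool) xs →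
  length (filterᵇ p xs) + length (filterᵇ (not ∘ p) xs) ≡ length xs
length-filterᵇ-partition p [] = refl
length-filterᵇ-partition p (x ∷ xs) with p x
... | true  = cong suc (length-filterᵇ-partition p xs)
... | false = trans (ℕP.+-suc _ _) (cong suc (length-filterᵇ-partition p xs))

∈-allSubsets : ∀ {m} (p : Subset m) → p ∈ₗ allSubsets m
∈-allSubsets [] = here refl
∈-allSubsets (outside ∷ p) = ∈-++⁺ˡ (∈-map⁺ (outside ∷_) (∈-allSubsets p))
∈-allSubsets {suc m} (inside ∷ p) =
  ∈-++⁺ʳ (map (outside ∷_) (allSubsets m)) (∈-map⁺ (inside ∷_) (∈-allSubsets p))

members-mono : ∀ {m} {p q : Subset m} → p ⊆ q → members p ⊆ₗ members q
members-mono {m} {p} {q} p⊆q = filter⁺′ (_∈? p) (_∈? q) p⊆q {allFin m} (λ x∈ → x∈)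

nonemptyᵇ-mono : ∀ {n} {p q : Subset n} → p ⊆ q → T (nonemptyᵇ p) → T (nonemptyᵇ q)
nonemptyᵇ-mono {n} p⊆q = any-mono (λ x∈p → fromWitness (p⊆q (toWitness x∈p))) (allFin n)

∩-monoʳ : ∀ {n} (p : Subset n) {q r} → q ⊆ r → p ∩ q ⊆ p ∩ r
∩-monoʳ p {q} q⊆r x∈ with x∈p∩q⁻ p q x∈
... | x∈p , x∈q = x∈p∩q⁺ (x∈p , q⊆r x∈q)

∈-foldr-∪⁺ˡ : ∀ {n} {X : Subset n} Ss {x} → x ∈ X → x ∈ foldr _∪_ X Ss
∈-foldr-∪⁺ˡ []       x∈X = x∈X
∈-foldr-∪⁺ˡ (S ∷ Ss) x∈X = x∈p∪q⁺ (inj₂ (∈-foldr-∪⁺ˡ Ss x∈X))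

∈-foldr-∪⁺ʳ : ∀ {n} {X S : Subset n} {Ss x} → S ∈ₗ Ss → x ∈ S → x ∈ foldr _∪_ X Ss
∈-foldr-∪⁺ʳ (here refl) x∈S = x∈p∪q⁺ (inj₁ x∈S)
∈-foldr-∪⁺ʳ (there S∈)  x∈S = x∈p∪q⁺ (inj₂ (∈-foldr-∪⁺ʳ S∈ x∈S))

foldr-∪-mono : ∀ {n} {X Y : Subset n} Ss {Ts} → X ⊆ Y → Ss ⊆ₗ Ts →
               foldr _∪_ X Ss ⊆ foldr _∪_ Y Ts
foldr-∪-mono []       {Ts} X⊆Y Ss⊆Ts x∈ = ∈-foldr-∪⁺ˡ Ts (X⊆Y x∈)
foldr-∪-mono (S ∷ Ss) X⊆Y Ss⊆Ts x∈ with x∈p∪q⁻ S _ x∈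
... | inj₁ x∈S    = ∈-foldr-∪⁺ʳ (Ss⊆Ts (here refl)) x∈S
... | inj₂ x∈rest = foldr-∪-mono Ss X⊆Y (Ss⊆Ts ∘ there) x∈rest

module _ {n m} (H : Hypergraph n m) where

  closeStep-mono : ∀ {A B : Subset m} {X Y : Subset n} → A ⊆ B → X ⊆ Y →
                   closeStep H A X ⊆ closeStep H B Y
  closeStep-mono {A} {B} {X} {Y} A⊆B X⊆Y = foldr-∪-mono _ X⊆Y
    (map⁺ (edge H) (filter⁺′ (T? ∘ meets X) (T? ∘ meets Y)
      (nonemptyᵇ-mono (∩-monoʳ _ X⊆Y)) (members-mono A⊆B)))
    where
    meets : Subset n → Fin m → Bool
    meets Z i = nonemptyᵇ (edge H i ∩ Z)

  component-mono : ∀ {A B : Subset m} → A ⊆ B → ∀ v → component H A v ⊆ component H B v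
  component-mono {A} {B} A⊆B v = iterate n
    where
    iterate : ∀ j → iter j (closeStep H A) ⁅ v ⁆ ⊆ iter j (closeStep H B) ⁅ v ⁆
    iterate zero    = λ x∈ → x∈
    iterate (suc j) = closeStep-mono A⊆B (iterate j)

  c-antitone : ∀ {A B : Subset m} → A ⊆ B → c H B ≤ c H A
  c-antitone {A} {B} A⊆B = Sublist.length-mono-≤
    (Sublist.filter⁺ (T? ∘ leastIn B) (T? ∘ leastIn A)
      (λ { refl → all⁻ _ ∘ All-resp-⊇ (members-mono (component-mono A⊆B _)) ∘ all⁺ _ _ })
      (Sublist.⊆-refl {x = allFin n}))
    where
    leastIn : Subset m → Fin n → Bool
    leastIn C v = all (λ u → toℕ v ≤ℕ toℕ u) (members (component H C v))

isNB-antitone : ∀ {n m} (H : Hypergraph n m) (η : Permutation′ m) {A B : Subset m} →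
                B ⊆ A → T (isNB H η A) → T (isNB H η B)
isNB-antitone {m = m} H η {A} {B} B⊆A = not-antitone (any-mono brokenIn-mono (allSubsets m))
  where
  brokenIn-mono : ∀ {C} → T (isδCycle H C ∧ brokenIn η C B) → T (isδCycle H C ∧ brokenIn η C A)
  brokenIn-mono {C} = ∧-monoʳ {isδCycle H C} (any-mono (λ {i} → ∧-monoʳ {isηMin η C i}
    (λ C∖i⊆B → fromWitness (λ {_} x∈ → B⊆A (toWitness C∖i⊆B x∈)))) (allFin m))

setsThrough : ∀ {m} → ℕ → Fin m → List (Subset m)
setsThrough {m} i e = filterᵇ (λ A → (e ∈ᵇ A) ∧ (∣ A ∣ ==ℕ i)) (allSubsets m)

joinsVia : ∀ {m} → (Fin m → Bool) → Fin m → Subset m → Bool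
joinsVia β e A = any (λ e′ → β e′ ∧ (A ⊆ᵇ (⁅ e ⁆ ∪ ⁅ e′ ⁆))) (members A)

filterᵇ-cong : ∀ {A : Set} {p q : A → Bool} → p ≗ q → filterᵇ p ≗ filterᵇ q
filterᵇ-cong {p = p} {q} p≗q =
  filter-≐ (T? ∘ p) (T? ∘ q) ((λ {x} → subst T (p≗q x)) , (λ {x} → subst T (sym (p≗q x))))

joinsVia-cong : ∀ {m} {β β′ : Fin m → Bool} → β ≗ β′ → ∀ e → joinsVia β e ≗ joinsVia β′ e
joinsVia-cong β≗β′ e A = cong or (map-cong (λ e′ → cong (_∧ _) (β≗β′ e′)) (members A))

decide-≤4 : ∀ {P : ℕ → Set} (P? : ∀ m → Dec (P m)) →
            {True (all? (λ (j : Fin 5) → P? (toℕ j)))} → ∀ {m} → m ≤ 4 → P m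
decide-≤4 {P} P? {holds} m≤4 = subst P (toℕ-fromℕ< (s≤s m≤4)) (toWitness holds (fromℕ< (s≤s m≤4)))

setsThrough-2-length : ∀ {m} → m ≤ 4 → (e : Fin m) → length (setsThrough 2 e) ≡ m ∸ 1
setsThrough-2-length = decide-≤4 {λ m → ∀ e → length (setsThrough {m} 2 e) ≡ m ∸ 1}
  (λ m → all? (λ e → length (setsThrough 2 e) ℕ.≟ m ∸ 1))

joinsVia-count : ∀ {m} → m ≤ 4 → (e : Fin m) (β : Fin m → Bool) →
  length (filterᵇ (joinsVia β e) (setsThrough 2 e)) ≤ length (filterᵇ β (allFin m))
joinsVia-count {m} m≤4 e β = subst₂ _≤_
  (cong length (filterᵇ-cong (joinsVia-cong (lookup∘tabulate β) e) (setsThrough 2 e)))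
  (cong length (filterᵇ-cong (lookup∘tabulate β) (allFin m)))
  (All.lookup (everyTable m≤4 e) (∈-allSubsets (tabulate β)))
  where
  Bounded : ∀ {m} → Fin m → Subset m → Set
  Bounded {m} e v =
    length (filterᵇ (joinsVia (lookup v) e) (setsThrough 2 e)) ≤ length (filterᵇ (lookup v) (allFin m))
  everyTable : ∀ {m} → m ≤ 4 → (e : Fin m) → All (Bounded e) (allSubsets m)
  everyTable = decide-≤4 {λ m → ∀ e → All (Bounded e) (allSubsets m)}
    (λ m → all? (λ e → All.all? (λ v → _ ℕ.≤? _) (allSubsets m)))

setsThrough-4 : (e : Fin 4) → setsThrough 4 e ≡ ⊤ ∷ []
setsThrough-4 =
  toWitness {a? = all? (λ e → List.≡-dec (Vec.≡-dec Bool._≟_) (setsThrough 4 e) (⊤ ∷ []))} tt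

setsThrough-3-length : (e : Fin 4) → length (setsThrough 3 e) ≡ 3
setsThrough-3-length = toWitness {a? = all? (λ e → length (setsThrough 3 e) ℕ.≟ 3)} tt

module _ {n m} (H : Hypergraph n m) (η : Permutation′ m) where

  NB≡filter-isNB : ∀ i e → NB H η i e ≡ filterᵇ (isNB H η) (setsThrough i e)
  NB≡filter-isNB i e = filterᵇ-∧ (isNB H η) _ (allSubsets m)

  NB⊆setsThrough : ∀ i e → NB H η i e Sublist.⊆ setsThrough i e
  NB⊆setsThrough i e =
    subst (Sublist._⊆ _) (sym (NB≡filter-isNB i e)) (Sublist.filter-⊆ (T? ∘ isNB H η) _)

  module _ (r : ℕ) (e : Fin m) where

    NB₂-length≤ : m ≤ 4 → length (NB*2 H r η e) + length (NB2-not* H r η e) ≤ m ∸ 1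
    NB₂-length≤ m≤4 = begin
      length (NB*2 H r η e) + length (NB2-not* H r η e)
        ≡⟨ length-filterᵇ-partition (joinsVia (inEr-1 H r e) e) (NB H η 2 e) ⟩
      length (NB H η 2 e)
        ≤⟨ Sublist.length-mono-≤ (NB⊆setsThrough 2 e) ⟩
      length (setsThrough 2 e)
        ≡⟨ setsThrough-2-length m≤4 e ⟩
      m ∸ 1
        ∎
      where open ℕP.≤-Reasoning

    -- NB*₂(e) injects into E_{r−1}(e) via {e, e′} ↦ e′; for m ≤ 4 this is checked
    -- against every possible value of E_{r−1}(e).
    NB*₂-length≤ : m ≤ 4 → length (NB*2 H r η e) ≤ length (Er-1 H r e)
    NB*₂-length≤ m≤4 = ℕP.≤-trans (Sublist.length-mono-≤ NB*₂⊆) (joinsVia-count m≤4 e β)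
      where
      β = inEr-1 H r e
      NB*₂⊆ : NB*2 H r η e Sublist.⊆ filterᵇ (joinsVia β e) (setsThrough 2 e)
      NB*₂⊆ = Sublist.filter⁺ (T? ∘ joinsVia β e) (T? ∘ joinsVia β e) (λ { refl p → p }) (NB⊆setsThrough 2 e)

Er-1-length≤ : ∀ {n m} (H : Hypergraph n m) r e → length (Er-1 H r e) ≤ m
Er-1-length≤ {m = m} H r e =
  subst (length (Er-1 H r e) ≤_) (length-tabulate {n = m} (λ i → i)) (length-filter (T? ∘ inEr-1 H r e) (allFin m))

module _ {n m} (H : Hypergraph n m) (r : ℕ) (k : ℤ) where

  exponent : Subset m → ℤ
  exponent A = ((+ c H A) ℤ.- (+ 1)) ℤ.- ((+ n) ℤ.- (+ r))

  weight : Subset m → ℚ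
  weight A = powℤ (k / 1) (exponent A)

  module _ (1≤k : 1ℚ ≤ℚ k / 1) where

    weight-nonNeg : ∀ A → 0ℚ ≤ℚ weight A
    weight-nonNeg A = powℤ-nonNeg 1≤k (exponent A)

    weight-antitone : ∀ {A B} → B ⊆ A → weight A ≤ℚ weight B
    weight-antitone B⊆A = powℤ-mono-≤ 1≤k
      (ℤP.+-monoˡ-≤ (ℤ.- ((+ n) ℤ.- (+ r))) (ℤP.+-monoˡ-≤ (ℤ.- (+ 1)) (+≤+ (c-antitone H B⊆A))))

  module _ (η : Permutation′ m) (e : Fin m) where

    oddTerm : ℕ → ℚ
    oddTerm i = sumℚ (map (λ A → weight A ℚ.* ((+ 1) / suc (2 ℕ.* (i ∸ 1)))) (NB H η (2 ℕ.* i ∸ 1) e))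

    oddSum : ℚ
    oddSum = sumFromTo 2 ⌊ m ℕ.+ 1 /2⌋ oddTerm

    evenSum : ℚ
    evenSum = sumFromTo 2 ⌊ m /2⌋ (λ i → sumℚ (map weight (NB H η (2 ℕ.* i) e)))

    oddSum-nonNeg : 1ℚ ≤ℚ k / 1 → 0ℚ ≤ℚ oddSum
    oddSum-nonNeg 1≤k = sumFromTo-nonNeg 2 ⌊ m ℕ.+ 1 /2⌋ oddTerm oddTerm-nonNeg
      where
      oddTerm-nonNeg : ∀ i → 0ℚ ≤ℚ oddTerm i
      oddTerm-nonNeg i = sumℚ-nonNeg _ (λ A → 0≤p*q (weight-nonNeg 1≤k A)
        (nonNegative⁻¹ _ {{normalize-nonNeg 1 (suc (2 ℕ.* (i ∸ 1)))}})) (NB H η (2 ℕ.* i ∸ 1) e)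

NB₄-sum≤NB₃-sum : ∀ {n} (H : Hypergraph n 4) r k η e → 1ℚ ≤ℚ k / 1 →
  sumℚ (map (weight H r k) (NB H η 4 e)) ≤ℚ sumℚ (map (λ A → weight H r k A ℚ.* ⅓) (NB H η 3 e))
NB₄-sum≤NB₃-sum H r k η e 1≤k = begin
  sumℚ (map w (NB H η 4 e))                    ≡⟨ cong (sumℚ ∘ map w) (NB≡filter-isNB H η 4 e) ⟩
  sumℚ (map w (filterᵇ ν (setsThrough 4 e)))   ≡⟨ cong (λ As → sumℚ (map w (filterᵇ ν As))) (setsThrough-4 e) ⟩
  sumℚ (map w (filterᵇ ν (⊤ ∷ [])))            ≤⟨ ⊤-dominated ⟩
  sumℚ (map w⅓ (filterᵇ ν (setsThrough 3 e)))  ≡⟨ cong (sumℚ ∘ map w⅓) (NB≡filter-isNB H η 3 e) ⟨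
  sumℚ (map w⅓ (NB H η 3 e))                   ∎
  where
  open ≤-Reasoning
  ν = isNB H η
  w = weight H r k
  w⅓ = λ A → w A ℚ.* ⅓
  ⊤-dominated = sum-filter-max≤⅓sum ν w (setsThrough 3 e) (setsThrough-3-length e) (isNB-antitone H η ⊆⊤)
    (λ Y → weight-antitone H r k 1≤k {⊤} {Y} ⊆⊤) (weight-nonNeg H r k 1≤k)

evenSum≤oddSum : ∀ {n m} (H : Hypergraph n m) r k η e → m ≤ 4 → 1ℚ ≤ℚ k / 1 →
                 evenSum H r k η e ≤ℚ oddSum H r k η e
evenSum≤oddSum H r k η e z≤n                          = oddSum-nonNeg H r k η e
evenSum≤oddSum H r k η e (s≤s z≤n)                    = oddSum-nonNeg H r k η e
evenSum≤oddSum H r k η e (s≤s (s≤s z≤n))              = oddSum-nonNeg H r k η e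
evenSum≤oddSum H r k η e (s≤s (s≤s (s≤s z≤n)))        = oddSum-nonNeg H r k η e
evenSum≤oddSum H r k η e (s≤s (s≤s (s≤s (s≤s z≤n)))) = +-monoˡ-≤ 0ℚ ∘ NB₄-sum≤NB₃-sum H r k η e

leadingTerms : ℕ → ℕ → ℚ → ℚ
leadingTerms a b q = (1ℚ ℚ.- ℕ→ℚ a ℚ.* powℤ q (ℤ.- (+ 1))) ℚ.- ℕ→ℚ b ℚ.* powℤ q (ℤ.- (+ 2))

leadingTerms≡1-at-bt² : ∀ a b {q} (1≤q : 1ℚ ≤ℚ q) →
                        leadingTerms a b q ≡ 1-at-bt² a b (Reciprocal.t 1≤q)
leadingTerms≡1-at-bt² a b 1≤q = cong₂ (λ x y → (1ℚ ℚ.- ℕ→ℚ a ℚ.* x) ℚ.- ℕ→ℚ b ℚ.* y)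
  (trans (powℤ-negative 0) (*-identityʳ t))
  (trans (powℤ-negative 1) (cong (t ℚ.*_) (*-identityʳ t)))
  where open Reciprocal 1≤q

module _ {n m} (H : Hypergraph n m) (r : ℕ) (η : Permutation′ m) (e : Fin m) (m≤4 : m ≤ 4) where

  private
    a = length (NB*2 H r η e)
    b = length (NB2-not* H r η e)

  leadingTerms-nonNeg-k≥2 : ∀ {kn} → length (Er-1 H r e) ≤ 1 → 2 ≤ kn → 0ℚ ≤ℚ leadingTerms a b (ℕ→ℚ kn)
  leadingTerms-nonNeg-k≥2 E≤1 2≤kn =
    subst (0ℚ ≤ℚ_) (sym (leadingTerms≡1-at-bt² a b 1≤q))
      (1-at-bt²-nonNeg-½ (ℕP.≤-trans (NB*₂-length≤ H η r e m≤4) E≤1)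
                         (ℕP.≤-trans (NB₂-length≤ H η r e m≤4) (ℕP.∸-monoˡ-≤ 1 m≤4))
                         0≤t (1/-antimono-≤ (ℕ→ℚ-mono-≤ 2≤kn)))
    where
    1≤q = ℕ→ℚ-mono-≤ (ℕP.≤-trans (s≤s z≤n) 2≤kn)
    open Reciprocal 1≤q

  leadingTerms-nonNeg-k≥m-1 : ∀ {kn} → 1 ≤ kn → m ∸ 1 ≤ kn → 0ℚ ≤ℚ leadingTerms a b (ℕ→ℚ kn)
  leadingTerms-nonNeg-k≥m-1 {kn} 1≤kn m∸1≤kn =
    subst (0ℚ ≤ℚ_) (sym (leadingTerms≡1-at-bt² a b 1≤q))
      (1-at-bt²-nonNeg {a} {b} 0≤t t≤1 (begin
        ℕ→ℚ (a + b) ℚ.* t   ≤⟨ *-monoʳ-≤-nonNeg t {{nonNegative 0≤t}} (ℕ→ℚ-mono-≤ a+b≤kn) ⟩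
        ℕ→ℚ kn ℚ.* t        ≡⟨ q*t≡1 ⟩
        1ℚ                  ∎))
    where
    a+b≤kn = ℕP.≤-trans (NB₂-length≤ H η r e m≤4) m∸1≤kn
    1≤q = ℕ→ℚ-mono-≤ 1≤kn
    open Reciprocal 1≤q
    open ≤-Reasoning

lemma3p1 : ∀ {n m r : ℕ} (H : Hypergraph n m) → Uniform H r → m ≤ 4 →
    (η : Permutation′ m) (e : Fin m) (k : ℤ) →
    ((length (Er-1 H r e) ≤ 1 × + 2 ≤ℤ k) ⊎ (2 ≤ length (Er-1 H r e) × (+ m) - (+ 1) ≤ℤ k)) →
    0ℚ ≤ℚ F H r η e k
lemma3p1 {m = zero} H _ _ η () k _
lemma3p1 {r = r} H _ m≤4 η e k (inj₁ (E≤1 , +≤+ {n = kn} 2≤kn)) =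
  0≤p+q-r (leadingTerms-nonNeg-k≥2 H r η e m≤4 E≤1 2≤kn)
          (evenSum≤oddSum H r k η e m≤4 (ℕ→ℚ-mono-≤ (ℕP.≤-trans (s≤s z≤n) 2≤kn)))
lemma3p1 {m = suc m′} {r} H _ m≤4 η e k (inj₂ (2≤E , +≤+ {n = kn} m′≤kn)) =
  0≤p+q-r (leadingTerms-nonNeg-k≥m-1 H r η e m≤4 1≤kn m′≤kn)
          (evenSum≤oddSum H r k η e m≤4 (ℕ→ℚ-mono-≤ 1≤kn))
  where
  1≤kn : 1 ≤ kn
  1≤kn = ℕP.≤-trans (ℕ.s≤s⁻¹ (ℕP.≤-trans 2≤E (Er-1-length≤ H r e))) m′≤kn
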